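{- Let $X$ be a shift space on the alphabet $A$ and let $w\in\mathcal L(X)$. Let $U\subset\mathcal L(X)$ be a finite $X$-maximal suffix code and let $V\subset\mathcal L(X)$ be a finite $X$-maximal prefix code. Let $\ell\in\mathcal L(X)$ be such that $A\ell\cap\mathcal L(X)\subset U$ and such that $\mathcal E_{A,V}(\ell w)$ is a tree. Set $U'=(U\setminus A\ell)\cup\{\ell\}$. Then $\mathcal E_{U',V}(w)$ is a tree if and only if $\mathcal E_{U,V}(w)$ is a tree.
   Context: A shift space on a finite alphabet $A$ is a closed shift-invariant subset of $A^{\mathbb Z}$; $\mathcal L(X)$ is its set of finite factors. A prefix (resp. suffix) code is a set of words none of which is a proper prefix (resp. suffix) of another; a prefix (resp. suffix) code $U\subset\mathcal L(X)$ is $X$-maximal if it is not properly contained in a prefix (resp. suffix) code contained in $\mathcal L(X)$. For sets of words $U,V$ and $w\in\mathcal L(X)$, let $L_U(w)=\{u\in U: uw\in\mathcal L(X)\}$, $R_V(w)=\{v\in V: wv\in\mathcal L(X)\}$; the generalized extension graph $\mathcal E_{U,V}(w)$ is the undirected bipartite graph with vertex set the disjoint union of $L_U(w)$ and $R_V(w)$ and edges the pairs $(u,v)\in L_U(w)\times R_V(w)$ with $uwv\in\mathcal L(X)$. In $\mathcal E_{A,V}(\ell w)$, $A$ denotes the set of letters (words of length $1$). -}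

module Defs where

open import Data.Nat using (ℕ; zero; suc; _≤_)
open import Data.Integer using (ℤ; _+_; _-_; ∣_∣; +_)
open import Data.Fin using (Fin)
open import Data.List using (List; []; _∷_; _++_; length; [_])
open import Data.List.Membership.Propositional using (_∈_)
open import Data.List.Relation.Unary.Linked using (Linked)
open import Data.List.Relation.Unary.Unique.Propositional using (Unique)
open import Data.Product using (Σ; ∃; _×_; _,_)
open import Data.Sum using (_⊎_; inj₁; inj₂)
open import Data.Empty using (⊥)
open import Relation.Nullary using (¬_)
open import Relation.Binary.PropositionalEquality using (_≡_)

Alphabet : ℕ → Set
Alphabet k = Fin k

Word : ℕ → Set
Word k = List (Alphabet k)

Config : ℕ → Set
Config k = ℤ → Alphabet k

σ : ∀ {k} → Config k → Config k
σ x i = x (i + + 1)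

σ⁻¹ : ∀ {k} → Config k → Config k
σ⁻¹ x i = x (i - + 1)

SubsetA : ℕ → Set₁
SubsetA k = Config k → Set

ShiftInvariant : ∀ {k} → SubsetA k → Set
ShiftInvariant {k} X = (∀ (x : Config k) → X x → X (σ x)) × (∀ (x : Config k) → X x → X (σ⁻¹ x))

-- closed in the product topology: x is in X whenever every central
-- cylinder around x meets X
Closed : ∀ {k} → SubsetA k → Set
Closed {k} X = ∀ (x : Config k) →
  (∀ (n : ℕ) → Σ (Config k) λ y → X y × (∀ (i : ℤ) → ∣ i ∣ ≤ n → y i ≡ x i)) → X x

record ShiftSpace (k : ℕ) : Set₁ where
  field
    pts       : SubsetA k
    invariant : ShiftInvariant pts
    closed    : Closed pts

window : ∀ {k} → Config k → ℤ → ℕ → Word k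
window x i zero = []
window x i (suc n) = x i ∷ window x (i + + 1) n

Lang : ∀ {k} → ShiftSpace k → Word k → Set
Lang X w = Σ _ λ x → ShiftSpace.pts X x × Σ ℤ λ i → window x i (length w) ≡ w

WordSet : ℕ → Set₁
WordSet k = Word k → Set

_⊆_ : ∀ {k} → WordSet k → WordSet k → Set
U ⊆ W = ∀ u → U u → W u

FiniteSet : ∀ {k} → WordSet k → Set
FiniteSet {k} U = Σ (List (Word k)) λ xs → ∀ u → U u → u ∈ xs

IsPrefix : ∀ {k} → Word k → Word k → Set
IsPrefix u v = ∃ λ t → u ++ t ≡ v

IsSuffix : ∀ {k} → Word k → Word k → Set
IsSuffix u v = ∃ λ t → t ++ u ≡ v

PrefixCode : ∀ {k} → WordSet k → Set
PrefixCode U = ∀ u v → U u → U v → IsPrefix u v → u ≡ v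

SuffixCode : ∀ {k} → WordSet k → Set
SuffixCode U = ∀ u v → U u → U v → IsSuffix u v → u ≡ v

XMaximalPrefixCode : ∀ {k} → ShiftSpace k → WordSet k → Set₁
XMaximalPrefixCode {k} X U =
  U ⊆ Lang X × PrefixCode U ×
  (∀ (W : WordSet k) → PrefixCode W → U ⊆ W → W ⊆ Lang X → W ⊆ U)

XMaximalSuffixCode : ∀ {k} → ShiftSpace k → WordSet k → Set₁
XMaximalSuffixCode {k} X U =
  U ⊆ Lang X × SuffixCode U ×
  (∀ (W : WordSet k) → SuffixCode W → U ⊆ W → W ⊆ Lang X → W ⊆ U)

Letters : ∀ {k} → WordSet k
Letters u = ∃ λ a → u ≡ [ a ]

-- Generalized extension graph E_{U,V}(w).
-- Vertices: inj₁ u for u ∈ L_U(w), inj₂ v for v ∈ R_V(w) (disjoint union).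
Vertex : ℕ → Set
Vertex k = Word k ⊎ Word k

IsVertex : ∀ {k} → ShiftSpace k → WordSet k → WordSet k → Word k → Vertex k → Set
IsVertex X U V w (inj₁ u) = U u × Lang X (u ++ w)
IsVertex X U V w (inj₂ v) = V v × Lang X (w ++ v)

Adj : ∀ {k} → ShiftSpace k → WordSet k → WordSet k → Word k → Vertex k → Vertex k → Set
Adj X U V w (inj₁ u) (inj₁ u') = ⊥
Adj X U V w (inj₂ v) (inj₂ v') = ⊥
Adj X U V w (inj₁ u) (inj₂ v) =
  IsVertex X U V w (inj₁ u) × IsVertex X U V w (inj₂ v) × Lang X (u ++ w ++ v)
Adj X U V w (inj₂ v) (inj₁ u) =
  IsVertex X U V w (inj₁ u) × IsVertex X U V w (inj₂ v) × Lang X (u ++ w ++ v)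

module Graph {V : Set} (isV : V → Set) (adj : V → V → Set) where

  data Walk : V → V → Set where
    here : ∀ {x} → Walk x x
    step : ∀ {x y z} → adj x y → Walk y z → Walk x z

  NonEmpty : Set
  NonEmpty = Σ V isV

  Connected : Set
  Connected = ∀ x y → isV x → isV y → Walk x y

  Cycle : Set
  Cycle = Σ V λ x → Σ (List V) λ xs →
    (3 ≤ length (x ∷ xs)) × Unique (x ∷ xs) × Linked adj (x ∷ xs ++ [ x ])

  Acyclic : Set
  Acyclic = ¬ Cycle

  IsTree : Set
  IsTree = NonEmpty × Connected × Acyclic

ExtTree : ∀ {k} → ShiftSpace k → WordSet k → WordSet k → Word k → Set
ExtTree X U V w = Graph.IsTree (IsVertex X U V w) (Adj X U V w)

replaceU : ∀ {k} → WordSet k → Word k → WordSet k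
replaceU U ℓ u = (U u × ¬ (∃ λ a → u ≡ a ∷ ℓ)) ⊎ (u ≡ ℓ)

module Submission where

-- Lemma 8.2.  Write G = E_{U,V}(w), G' = E_{U',V}(w) and T = E_{A,V}(ℓw).
-- Call a left vertex of G of the form aℓ "merged": G' is obtained from G by
-- identifying all merged vertices into the single vertex ℓ (ℓ itself is not
-- in U, because U is a suffix code containing some aℓ).  The map `collapse`
-- realises this identification, `attach` (a ↦ aℓ) embeds T into G, and
-- `detach` (aℓ ↦ a) maps the merged and right vertices of G back into T.
--   * Nonemptiness and connectivity: collapse sends walks of G to walks of
--     G' and is onto the vertices of G'; conversely a walk of G' lifts to G,
--     the connectivity of T being used to move between merged vertices.
--   * Acyclicity: a cycle of G either avoids left vertices other than the
--     merged ones (it is then a cycle of T), or avoids merged vertices (it is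
--     a cycle of G'), or can be shortcut through ℓ into a cycle of G'.
--     A cycle of G' through ℓ leaves and re-enters ℓ at right vertices v₁, vₘ;
--     closing the G-path v₁ ⋯ vₘ by a path vₘ ⇝ v₁ through T gives a
--     closed walk of G that contains a cycle.

open import Defs
open import Data.Nat using (ℕ; suc; s≤s; z≤n) renaming (_≤_ to _≤ℕ_)
open import Data.Nat.Properties using (≤-trans; +-comm)
open import Data.Integer using (_+_; _-_; +_; -_)
import Data.Integer.Properties as ℤ
open import Data.Fin using () renaming (_≟_ to _≟ᶠ_)
open import Data.List using (List; []; _∷_; _++_; [_]; length; map)
open import Data.List.Properties using (++-assoc; length-++; length-map; map-++; ∷-injective; ≡-dec; length-++-≤ʳ)
open import Data.List.Relation.Unary.Linked using (Linked; []; [-]; _∷_; tail)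
import Data.List.Relation.Unary.Linked as Linked
open import Data.List.Relation.Unary.Linked.Properties using () renaming (map⁺ to Linked-map⁺)
open import Data.List.Relation.Unary.All using (All; []; _∷_)
import Data.List.Relation.Unary.All as All
open import Data.List.Relation.Unary.All.Properties using (¬Any⇒All¬; ++⁺; ++⁻ˡ; ++⁻ʳ; map⁺)
open import Data.List.Relation.Unary.Any using (Any; here; there; any?)
open import Data.List.Relation.Unary.AllPairs using ([]; _∷_)
import Data.List.Relation.Unary.AllPairs as AllPairs
open import Data.List.Relation.Unary.Unique.Propositional using (Unique)
import Data.List.Relation.Unary.Unique.Propositional.Properties as Unique
open import Data.List.Membership.Propositional using (_∈_; find)
open import Data.List.Membership.Propositional.Properties using (∈-∃++)
open import Data.Product using (Σ; _×_; _,_; proj₁; proj₂)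
open import Data.Sum using (_⊎_; inj₁; inj₂)
import Data.Sum.Properties as Sum
open import Data.Empty using (⊥; ⊥-elim)
open import Data.Unit using (⊤; tt)
open import Relation.Nullary using (¬_; yes; no)
open import Relation.Unary using (Decidable)
open import Relation.Binary.Definitions using (DecidableEquality)
open import Relation.Binary.PropositionalEquality using (_≡_; refl; sym; trans; cong; cong₂; subst; subst₂; module ≡-Reasoning)
open import Function.Bundles using (_⇔_; mk⇔)

module Lists {V : Set} where

  lastOf : V → List V → V
  lastOf x [] = x
  lastOf x (y ∷ ys) = lastOf y ys

  lastOf-++ : ∀ a A x B → lastOf a (A ++ x ∷ B) ≡ lastOf x B
  lastOf-++ a [] x B = refl
  lastOf-++ a (b ∷ A) x B = lastOf-++ b A x B

  lastOf-split : ∀ {y zs} A x B → y ∷ zs ≡ A ++ x ∷ B → lastOf x B ≡ lastOf y zs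
  lastOf-split [] x B refl = refl
  lastOf-split (a ∷ A) x B refl = sym (lastOf-++ a A x B)

  lastOf-map : (f : V → V) → ∀ x xs → lastOf (f x) (map f xs) ≡ f (lastOf x xs)
  lastOf-map f x [] = refl
  lastOf-map f x (y ∷ ys) = lastOf-map f y ys

  lastOf-∈ : ∀ y ys → lastOf y ys ∈ y ∷ ys
  lastOf-∈ y [] = here refl
  lastOf-∈ y (z ∷ zs) = there (lastOf-∈ z zs)

  All-loop : ∀ {P : V → Set} {x xs} → All P (x ∷ xs) → All P (x ∷ xs ++ [ x ])
  All-loop (px ∷ ps) = px ∷ ++⁺ ps (px ∷ [])

  All-swap : ∀ {P : V → Set} xs ys → All P (xs ++ ys) → All P (ys ++ xs)
  All-swap xs ys a = ++⁺ (++⁻ʳ xs a) (++⁻ˡ xs a)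

  All-dropMiddle : ∀ {P : V → Set} xs ys zs → All P (xs ++ ys ++ zs) → All P (zs ++ xs)
  All-dropMiddle xs ys zs a =
    ++⁻ʳ ys (subst (All _) (++-assoc ys zs xs) (All-swap xs (ys ++ zs) a))

  module _ {R : V → V → Set} where

    Linked-prefix : ∀ xs ys → Linked R (xs ++ ys) → Linked R xs
    Linked-prefix [] ys _ = []
    Linked-prefix (x ∷ []) ys _ = [-]
    Linked-prefix (x ∷ y ∷ xs) ys (r ∷ l) = r ∷ Linked-prefix (y ∷ xs) ys l

    Linked-suffix : ∀ xs ys → Linked R (xs ++ ys) → Linked R ys
    Linked-suffix [] ys l = l
    Linked-suffix (x ∷ xs) ys l = Linked-suffix xs ys (tail l)

    Linked-upTo : ∀ x P y Q → Linked R (x ∷ P ++ y ∷ Q) → Linked R (x ∷ P ++ [ y ])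
    Linked-upTo x [] y Q (r ∷ _) = r ∷ [-]
    Linked-upTo x (p ∷ P) y Q (r ∷ l) = r ∷ Linked-upTo p P y Q l

    Linked-from : ∀ x P y Q → Linked R (x ∷ P ++ y ∷ Q) → Linked R (y ∷ Q)
    Linked-from x [] y Q (_ ∷ l) = l
    Linked-from x (p ∷ P) y Q (_ ∷ l) = Linked-from p P y Q l

    Linked-join : ∀ x xs ys → Linked R (x ∷ xs) → Linked R (lastOf x xs ∷ ys) → Linked R (x ∷ xs ++ ys)
    Linked-join x [] ys l m = m
    Linked-join x (y ∷ xs) ys (r ∷ l) m = r ∷ Linked-join y xs ys l m

    Linked-glue : ∀ xs a ys → Linked R (xs ++ [ a ]) → Linked R (a ∷ ys) → Linked R (xs ++ a ∷ ys)
    Linked-glue [] a ys _ m = m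
    Linked-glue (x ∷ []) a ys (r ∷ _) m = r ∷ m
    Linked-glue (x ∷ y ∷ xs) a ys (r ∷ l) m = r ∷ Linked-glue (y ∷ xs) a ys l m

    Linked-lastStep : ∀ x xs y → Linked R (x ∷ xs ++ [ y ]) → R (lastOf x xs) y
    Linked-lastStep x [] y (r ∷ _) = r
    Linked-lastStep x (z ∷ zs) y (_ ∷ l) = Linked-lastStep z zs y l

    Linked-sources : ∀ xs y → Linked R (xs ++ [ y ]) → All (λ a → Σ V (R a)) xs
    Linked-sources [] y _ = []
    Linked-sources (x ∷ []) y (r ∷ _) = (_ , r) ∷ []
    Linked-sources (x ∷ z ∷ xs) y (r ∷ l) = (_ , r) ∷ Linked-sources (z ∷ xs) y l

  Linked-image : ∀ {R S : V → V → Set} (f : V → V) → (∀ {x y} → R x y → S (f x) (f y)) →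
                 ∀ {xs} → Linked R xs → Linked S (map f xs)
  Linked-image f h l = Linked-map⁺ (Linked.map h l)

  Linked-restrict : ∀ {R S : V → V → Set} {P : V → Set} → (∀ {x y} → P x → P y → R x y → S x y) →
                    ∀ {xs} → All P xs → Linked R xs → Linked S xs
  Linked-restrict h _ [] = []
  Linked-restrict h _ [-] = [-]
  Linked-restrict h (px ∷ py ∷ ps) (r ∷ l) = h px py r ∷ Linked-restrict h (py ∷ ps) l

  Unique-++ˡ : ∀ (xs : List V) {ys : List V} → Unique (xs ++ ys) → Unique xs
  Unique-++ˡ [] _ = []
  Unique-++ˡ (x ∷ xs) (a ∷ u) = ++⁻ˡ xs a ∷ Unique-++ˡ xs u

  Unique-++ʳ : ∀ (xs : List V) {ys : List V} → Unique (xs ++ ys) → Unique ys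
  Unique-++ʳ [] u = u
  Unique-++ʳ (x ∷ xs) (a ∷ u) = Unique-++ʳ xs u

  Unique-disjoint : ∀ (xs : List V) {ys : List V} → Unique (xs ++ ys) → ∀ {v} → v ∈ xs → v ∈ ys → ⊥
  Unique-disjoint (x ∷ xs) (a ∷ u) (here refl) q = All.lookup (++⁻ʳ xs a) q refl
  Unique-disjoint (x ∷ xs) (a ∷ u) (there p) q = Unique-disjoint xs u p q

  Unique-swap : ∀ (xs ys : List V) → Unique (xs ++ ys) → Unique (ys ++ xs)
  Unique-swap xs ys u =
    Unique.++⁺ (Unique-++ʳ xs u) (Unique-++ˡ xs u) (λ (p , q) → Unique-disjoint xs u q p)

  Unique-dropMiddle : ∀ xs ys zs → Unique (xs ++ ys ++ zs) → Unique (zs ++ xs)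
  Unique-dropMiddle xs ys zs u =
    Unique-++ʳ ys (subst Unique (++-assoc ys zs xs) (Unique-swap xs (ys ++ zs) u))

  Unique-mapOn : ∀ {P : V → Set} (f : V → V) → (∀ {a b} → P a → P b → f a ≡ f b → a ≡ b) →
                 ∀ {xs} → All P xs → Unique xs → Unique (map f xs)
  Unique-mapOn f inj [] [] = []
  Unique-mapOn {P} f inj (px ∷ ps) (a ∷ u) = distinct px ps a ∷ Unique-mapOn f inj ps u
    where
    distinct : ∀ {x ys} → P x → All P ys → All (λ y → ¬ x ≡ y) ys → All (λ y → ¬ f x ≡ y) (map f ys)
    distinct px [] [] = []
    distinct px (py ∷ qs) (n ∷ ns) = (λ e → n (inj px py e)) ∷ distinct px qs ns

  module _ {P : V → Set} (P? : Decidable P) where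

    splitAtFirst : ∀ xs → Any P xs →
      Σ (List V) λ B → Σ V λ t → Σ (List V) λ M → xs ≡ B ++ t ∷ M × All (λ v → ¬ P v) B × P t
    splitAtFirst (x ∷ xs) a with P? x
    ... | yes px = [] , x , xs , refl , [] , px
    splitAtFirst (x ∷ xs) (here px) | no npx = ⊥-elim (npx px)
    splitAtFirst (x ∷ xs) (there a) | no npx with splitAtFirst xs a
    ... | B , t , M , refl , nB , pt = x ∷ B , t , M , refl , npx ∷ nB , pt

    splitAtLast : ∀ xs → Any P xs →
      Σ (List V) λ D → Σ V λ t → Σ (List V) λ A → xs ≡ D ++ t ∷ A × P t × All (λ v → ¬ P v) A
    splitAtLast (x ∷ xs) a with any? P? xs
    ... | yes a' with splitAtLast xs a'
    ...   | D , t , A , refl , pt , nA = x ∷ D , t , A , refl , pt , nA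
    splitAtLast (x ∷ xs) (here px) | no na = [] , x , xs , refl , px , ¬Any⇒All¬ xs na
    splitAtLast (x ∷ xs) (there a) | no na = ⊥-elim (na a)

module Cycles {V : Set} (_≟_ : DecidableEquality V) where

  open Lists {V}
  open import Data.List.Membership.DecPropositional _≟_ using (_∈?_)
  open import Data.List.Relation.Unary.Unique.DecPropositional _≟_ using (unique?)

  IsCycle : (V → V → Set) → V → List V → Set
  IsCycle R x xs = (3 ≤ℕ length (x ∷ xs)) × Unique (x ∷ xs) × Linked R (x ∷ xs ++ [ x ])

  rotateCycle : ∀ {R} {x xs} → IsCycle R x xs → ∀ {y} → y ∈ x ∷ xs → Σ (List V) (IsCycle R y)
  rotateCycle {R} {x} {xs} c {y} y∈ with ∈-∃++ y∈
  ... | [] , Q , refl = xs , c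
  ... | (p ∷ P) , Q , refl = Q ++ p ∷ P , len , uq , lk
    where
    len : 3 ≤ℕ length (y ∷ Q ++ p ∷ P)
    len = subst (3 ≤ℕ_) (trans (length-++ (p ∷ P) {y ∷ Q})
             (trans (+-comm (length (p ∷ P)) (length (y ∷ Q)))
                    (sym (length-++ (y ∷ Q) {p ∷ P})))) (proj₁ c)
    uq : Unique (y ∷ Q ++ p ∷ P)
    uq = Unique-swap (p ∷ P) (y ∷ Q) (proj₁ (proj₂ c))
    loop : Linked R (p ∷ P ++ y ∷ Q ++ [ p ])
    loop = subst (λ z → Linked R (p ∷ z)) (++-assoc P (y ∷ Q) [ p ]) (proj₂ (proj₂ c))
    lk : Linked R (y ∷ (Q ++ p ∷ P) ++ [ y ])
    lk = subst (λ z → Linked R (y ∷ z)) (sym (++-assoc Q (p ∷ P) [ y ]))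
           (Linked-glue (y ∷ Q) p (P ++ [ y ])
             (Linked-from p P y (Q ++ [ p ]) loop) (Linked-upTo p P y (Q ++ [ p ]) loop))

  erasePath : ∀ {R : V → V → Set} (P : V → Set) x xs → Linked R (x ∷ xs) → All P (x ∷ xs) →
    Σ (List V) λ ys → Linked R (x ∷ ys) × Unique (x ∷ ys) × lastOf x ys ≡ lastOf x xs × All P (x ∷ ys)
  erasePath P x [] _ p = [] , [-] , ([] ∷ []) , refl , p
  erasePath {R} P x (y ∷ xs) (r ∷ l) (px ∷ ps) with erasePath P y xs l ps
  ... | zs , lz , uz , ez , pz with x ∈? (y ∷ zs)
  ...   | no x∉ = (y ∷ zs) , r ∷ lz , (¬Any⇒All¬ (y ∷ zs) x∉ ∷ uz) , ez , px ∷ pz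
  ...   | yes x∈ with ∈-∃++ x∈
  ...     | A , B , eq = B , Linked-suffix A (x ∷ B) (subst (Linked R) eq lz) ,
                  Unique-++ʳ A (subst Unique eq uz) , trans (lastOf-split A x B eq) ez ,
                  ++⁻ʳ A (subst (All P) eq pz)

  NonBacktracking : List V → Set
  NonBacktracking (x ∷ y ∷ z ∷ r) = ¬ x ≡ z × NonBacktracking (y ∷ z ∷ r)
  NonBacktracking _ = ⊤

  NonBacktracking-tail : ∀ x xs → NonBacktracking (x ∷ xs) → NonBacktracking xs
  NonBacktracking-tail x [] _ = tt
  NonBacktracking-tail x (y ∷ []) _ = tt
  NonBacktracking-tail x (y ∷ z ∷ r) (_ , n) = n

  Unique⇒NonBacktracking : ∀ {xs} → Unique xs → NonBacktracking xs
  Unique⇒NonBacktracking {[]} _ = tt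
  Unique⇒NonBacktracking {x ∷ []} _ = tt
  Unique⇒NonBacktracking {x ∷ y ∷ []} _ = tt
  Unique⇒NonBacktracking {x ∷ y ∷ z ∷ r} ((_ ∷ d ∷ _) ∷ u) = d , Unique⇒NonBacktracking u

  NonBacktracking-join : (Q : V → Set) → ∀ x xs ys →
    NonBacktracking (x ∷ xs) → NonBacktracking (lastOf x xs ∷ ys) → All Q (x ∷ xs) →
    (∀ {p z zs} → Q p → ys ≡ z ∷ zs → ¬ p ≡ z) → NonBacktracking (x ∷ xs ++ ys)
  NonBacktracking-join Q x [] ys _ nb _ _ = nb
  NonBacktracking-join Q x (y ∷ []) [] _ nb _ _ = tt
  NonBacktracking-join Q x (y ∷ []) (z ∷ zs) _ nb (qx ∷ _) turn = turn qx refl , nb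
  NonBacktracking-join Q x (y ∷ z ∷ r) ys (d , nb₁) nb₂ (qx ∷ qs) turn =
    d , NonBacktracking-join Q y (z ∷ r) ys nb₁ nb₂ qs turn

  cycleOfClosedWalk : ∀ {R : V → V → Set} → (∀ {x} → R x x → ⊥) → ∀ x xs → Linked R (x ∷ xs) →
    NonBacktracking (x ∷ xs) → ¬ Unique (x ∷ xs) → Σ V λ c → Σ (List V) (IsCycle R c)
  cycleOfClosedWalk irr x [] l nb nu = ⊥-elim (nu ([] ∷ []))
  cycleOfClosedWalk {R} irr x (y ∷ ys) l nb nu with unique? (y ∷ ys)
  ... | no nu' = cycleOfClosedWalk irr y ys (tail l) (NonBacktracking-tail x _ nb) nu'
  ... | yes u with x ∈? (y ∷ ys)
  ...   | no x∉ = ⊥-elim (nu (¬Any⇒All¬ (y ∷ ys) x∉ ∷ u))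
  ...   | yes x∈ with ∈-∃++ x∈
  ...     | A , B , eq = x , A , length-ok A lk nb' ,
               (¬Any⇒All¬ A (λ p → Unique-disjoint A u' p (here refl)) ∷ Unique-++ˡ A u') ,
               Linked-upTo x A x B lk
    where
    u' : Unique (A ++ x ∷ B)
    u' = subst Unique eq u
    lk : Linked R (x ∷ A ++ x ∷ B)
    lk = subst (λ z → Linked R (x ∷ z)) eq l
    nb' : NonBacktracking (x ∷ A ++ x ∷ B)
    nb' = subst (λ z → NonBacktracking (x ∷ z)) eq nb
    length-ok : ∀ A → Linked R (x ∷ A ++ x ∷ B) → NonBacktracking (x ∷ A ++ x ∷ B) → 3 ≤ℕ length (x ∷ A)
    length-ok [] (r ∷ _) _ = ⊥-elim (irr r)
    length-ok (a ∷ []) _ (d , _) = ⊥-elim (d refl)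
    length-ok (a ∷ b ∷ A) _ _ = s≤s (s≤s (s≤s z≤n))

  -- A path a ⇝ b followed by a path b ⇝ a passing through a contains a cycle,
  -- provided the second path does not leave b along the edge by which the
  -- first one entered it (the vertices of the first path satisfy Q, and no
  -- vertex satisfying Q is the one following b).
  cycleOfTwoPaths : ∀ {R : V → V → Set} (Q : V → Set) → (∀ {x} → R x x → ⊥) →
    ∀ a ys zs → Linked R (a ∷ ys) → Unique (a ∷ ys) → All Q (a ∷ ys) →
    Linked R (lastOf a ys ∷ zs) → Unique (lastOf a ys ∷ zs) → a ∈ zs →
    (∀ {p z zs'} → Q p → zs ≡ z ∷ zs' → ¬ p ≡ z) →
    Σ V λ c → Σ (List V) (IsCycle R c)
  cycleOfTwoPaths Q irr a ys zs lk uq q lk' uq' a∈zs turn =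
    cycleOfClosedWalk irr a (ys ++ zs) (Linked-join a ys zs lk lk')
      (NonBacktracking-join Q a ys zs (Unique⇒NonBacktracking uq) (Unique⇒NonBacktracking uq') q turn)
      (λ { (a∉ ∷ _) → All.lookup (++⁻ʳ ys a∉) a∈zs refl })

module Walks {A : Set} {isV : A → Set} {adj : A → A → Set} where

  open Graph isV adj using (Walk; here; step)
  open Lists {A}

  walk-map : ∀ {isV' : A → Set} {adj' : A → A → Set} (f : A → A) →
    (∀ {a b} → adj a b → adj' (f a) (f b)) → ∀ {x y} → Walk x y → Graph.Walk isV' adj' (f x) (f y)
  walk-map f h here = Graph.here
  walk-map f h (step e W) = Graph.step (h e) (walk-map f h W)

  walk-++ : ∀ {x y z} → Walk x y → Walk y z → Walk x z
  walk-++ here W = W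
  walk-++ (step e W₁) W = step e (walk-++ W₁ W)

  walk→linked : (P : A → Set) → (∀ {a b} → adj a b → P b) → ∀ {x y} → P x → Walk x y →
    Σ (List A) λ xs → Linked adj (x ∷ xs) × lastOf x xs ≡ y × All P (x ∷ xs)
  walk→linked P target px here = [] , [-] , refl , px ∷ []
  walk→linked P target px (step e W) with walk→linked P target (target e) W
  ... | xs , l , eq , ps = _ ∷ xs , e ∷ l , eq , px ∷ ps

module Factors {k} (X : ShiftSpace k) where

  lang-suffix : ∀ (u v : Word k) → Lang X (u ++ v) → Lang X v
  lang-suffix [] v l = l
  lang-suffix (a ∷ u) v (x , px , i , e) = lang-suffix u v (x , px , i + + 1 , proj₂ (∷-injective e))

  window-prefix : ∀ (x : Config k) i (u v : Word k) →
    window x i (length (u ++ v)) ≡ u ++ v → window x i (length u) ≡ u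
  window-prefix x i [] v e = refl
  window-prefix x i (a ∷ u) v e =
    cong₂ _∷_ (proj₁ (∷-injective e)) (window-prefix x (i + + 1) u v (proj₂ (∷-injective e)))

  lang-prefix : ∀ (u v : Word k) → Lang X (u ++ v) → Lang X u
  lang-prefix u v (x , px , i , e) = x , px , i , window-prefix x i u v e

  lang-extendLeft : ∀ (u : Word k) → Lang X u → Σ (Alphabet k) λ a → Lang X (a ∷ u)
  lang-extendLeft u (x , px , i , e) = x (i - + 1) , x , px , i - + 1 ,
      cong (x (i - + 1) ∷_) (trans (cong (λ j → window x j (length u)) back) e)
    where
    back : (i - + 1) + + 1 ≡ i
    back = trans (ℤ.+-assoc i (- + 1) (+ 1))
             (trans (cong (λ z → i + z) (ℤ.+-inverseˡ (+ 1))) (ℤ.+-identityʳ i))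

module ExtGraph {k} (X : ShiftSpace k) (U V : WordSet k) (w : Word k) where

  adj-sym : ∀ x y → Adj X U V w x y → Adj X U V w y x
  adj-sym (inj₁ u) (inj₂ v) e = e
  adj-sym (inj₂ v) (inj₁ u) e = e

  adj-source : ∀ x y → Adj X U V w x y → IsVertex X U V w x
  adj-source (inj₁ u) (inj₂ v) e = proj₁ e
  adj-source (inj₂ v) (inj₁ u) e = proj₁ (proj₂ e)

  adj-target : ∀ x y → Adj X U V w x y → IsVertex X U V w y
  adj-target (inj₁ u) (inj₂ v) e = proj₁ (proj₂ e)
  adj-target (inj₂ v) (inj₁ u) e = proj₁ e

  adj-irrefl : ∀ x → Adj X U V w x x → ⊥
  adj-irrefl (inj₁ u) ()
  adj-irrefl (inj₂ v) ()

-- The setting of Lemma 8.2; only the suffix-code property of U is needed.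
module Replacement {k} (X : ShiftSpace k) (w : Word k) (U V : WordSet k) (ℓ : Word k)
  (Lℓ : Lang X ℓ) (suffixU : SuffixCode U)
  (AℓU : ∀ (a : Alphabet k) → Lang X (a ∷ ℓ) → U (a ∷ ℓ)) where

  open Factors X
  open Lists

  Vtx : Set
  Vtx = Vertex k

  _≟w_ : DecidableEquality (Word k)
  _≟w_ = ≡-dec _≟ᶠ_

  _≟v_ : DecidableEquality Vtx
  _≟v_ = Sum.≡-dec _≟w_ _≟w_

  open Cycles _≟v_
  open import Data.List.Membership.DecPropositional _≟v_ using (_∈?_)

  isG isG' isT : Vtx → Set
  isG = IsVertex X U V w
  isG' = IsVertex X (replaceU U ℓ) V w
  isT = IsVertex X Letters V (ℓ ++ w)

  adjG adjG' adjT : Vtx → Vtx → Set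
  adjG = Adj X U V w
  adjG' = Adj X (replaceU U ℓ) V w
  adjT = Adj X Letters V (ℓ ++ w)

  module EG = ExtGraph X U V w
  module EG' = ExtGraph X (replaceU U ℓ) V w
  module ET = ExtGraph X Letters V (ℓ ++ w)

  WalkG WalkG' : Vtx → Vtx → Set
  WalkG = Graph.Walk isG adjG
  WalkG' = Graph.Walk isG' adjG'

  ℓ' : Vtx
  ℓ' = inj₁ ℓ

  -- ℓ is not in U: some aℓ is in U, and ℓ is a proper suffix of it.
  ℓ∉U : ¬ U ℓ
  ℓ∉U Uℓ with lang-extendLeft ℓ Lℓ
  ... | a , Laℓ = shorter (cong length (suffixU ℓ (a ∷ ℓ) Uℓ (AℓU a Laℓ) ([ a ] , refl)))
    where
    shorter : ∀ {n} → n ≡ suc n → ⊥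
    shorter ()

  Extends : Word k → Set
  Extends u = Σ (Alphabet k) λ a → u ≡ a ∷ ℓ

  extends? : Decidable Extends
  extends? [] = no (λ { (a , ()) })
  extends? (b ∷ u) with u ≟w ℓ
  ... | yes refl = yes (b , refl)
  ... | no u≢ℓ = no (λ { (a , e) → u≢ℓ (proj₂ (∷-injective e)) })

  Merged Kept : Vtx → Set
  Merged (inj₁ u) = Extends u
  Merged (inj₂ _) = ⊥
  Kept (inj₁ u) = ¬ Extends u
  Kept (inj₂ _) = ⊥

  merged? : Decidable Merged
  merged? (inj₁ u) = extends? u
  merged? (inj₂ _) = no (λ ())

  kept? : Decidable Kept
  kept? (inj₁ u) with extends? u
  ... | yes e = no (λ n → n e)
  ... | no n = yes n
  kept? (inj₂ _) = no (λ ())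

  kept⇒¬merged : ∀ x → Kept x → ¬ Merged x
  kept⇒¬merged (inj₁ u) n = n

  -- Left vertices can only be adjacent to right vertices.
  kept-merged-nonadjacent : ∀ {x y} → Kept x → Merged y → ¬ adjG x y
  kept-merged-nonadjacent {inj₁ _} {inj₁ _} _ _ ()
  kept-merged-nonadjacent {inj₂ _} ()

  collapse : Vtx → Vtx
  collapse (inj₁ u) with extends? u
  ... | yes _ = ℓ'
  ... | no _ = inj₁ u
  collapse (inj₂ v) = inj₂ v

  collapse-extends : ∀ a → collapse (inj₁ (a ∷ ℓ)) ≡ ℓ'
  collapse-extends a with extends? (a ∷ ℓ)
  ... | yes _ = refl
  ... | no n = ⊥-elim (n (a , refl))

  collapse-merged : ∀ t → Merged t → collapse t ≡ ℓ'
  collapse-merged (inj₁ .(a ∷ ℓ)) (a , refl) = collapse-extends a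

  collapse-id : ∀ x → ¬ Merged x → collapse x ≡ x
  collapse-id (inj₁ u) nm with extends? u
  ... | yes m = ⊥-elim (nm m)
  ... | no _ = refl
  collapse-id (inj₂ v) _ = refl

  map-collapse-id : ∀ xs → All (λ v → ¬ Merged v) xs → map collapse xs ≡ xs
  map-collapse-id [] _ = refl
  map-collapse-id (x ∷ xs) (n ∷ ns) = cong₂ _∷_ (collapse-id x n) (map-collapse-id xs ns)

  collapse-vertex : ∀ {x} → isG x → isG' (collapse x)
  collapse-vertex {inj₁ u} (Uu , Luw) with extends? u
  ... | yes (a , refl) = inj₂ refl , lang-suffix [ a ] (ℓ ++ w) Luw
  ... | no n = inj₁ (Uu , n) , Luw
  collapse-vertex {inj₂ v} p = p

  collapse-leftEdge : ∀ u v → adjG (inj₁ u) (inj₂ v) → adjG' (collapse (inj₁ u)) (inj₂ v)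
  collapse-leftEdge u v ((Uu , Luw) , (Vv , Lwv) , Luwv) with extends? u
  ... | yes (a , refl) = (inj₂ refl , lang-suffix [ a ] (ℓ ++ w) Luw) , (Vv , Lwv) ,
                         lang-suffix [ a ] (ℓ ++ w ++ v) Luwv
  ... | no n = (inj₁ (Uu , n) , Luw) , (Vv , Lwv) , Luwv

  collapse-edge : ∀ {x y} → adjG x y → adjG' (collapse x) (collapse y)
  collapse-edge {inj₁ u} {inj₂ v} e = collapse-leftEdge u v e
  collapse-edge {inj₂ v} {inj₁ u} e = EG'.adj-sym (collapse (inj₁ u)) (inj₂ v) (collapse-leftEdge u v e)

  unmergedEdge : ∀ {x y} → ¬ Merged x → ¬ Merged y → adjG x y → adjG' x y
  unmergedEdge {x} {y} nx ny e = subst₂ adjG' (collapse-id x nx) (collapse-id y ny) (collapse-edge e)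

  vertexG≢ℓ : ∀ {x} → isG x → ¬ ℓ' ≡ x
  vertexG≢ℓ (Uℓ , _) refl = ℓ∉U Uℓ

  vertexG'→G : ∀ {x} → isG' x → ¬ ℓ' ≡ x → isG x
  vertexG'→G {inj₁ u} (inj₁ (Uu , _) , Luw) _ = Uu , Luw
  vertexG'→G {inj₁ u} (inj₂ refl , _) n = ⊥-elim (n refl)
  vertexG'→G {inj₂ v} p _ = p

  vertexG'-unmerged : ∀ {x} → isG' x → ¬ ℓ' ≡ x → ¬ Merged x
  vertexG'-unmerged {inj₁ u} (inj₁ (_ , n) , _) _ = n
  vertexG'-unmerged {inj₁ u} (inj₂ refl , _) ne = ⊥-elim (ne refl)
  vertexG'-unmerged {inj₂ v} _ _ = λ ()

  edgeG'→G : ∀ {x y} → adjG' x y → ¬ ℓ' ≡ x → ¬ ℓ' ≡ y → adjG x y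
  edgeG'→G {inj₁ u} {inj₂ v} (p , q , L) nx ny = vertexG'→G p nx , q , L
  edgeG'→G {inj₂ v} {inj₁ u} (p , q , L) nx ny = vertexG'→G p ny , q , L

  pathAvoidingℓ : ∀ {xs} → All (λ y → ¬ ℓ' ≡ y) xs → Linked adjG' xs → Linked adjG xs
  pathAvoidingℓ = Linked-restrict (λ nx ny e → edgeG'→G e nx ny)

  rightVertexT : ∀ {v} → V v → Lang X (ℓ ++ w ++ v) → isT (inj₂ v)
  rightVertexT {v} Vv L = Vv , subst (Lang X) (sym (++-assoc ℓ w v)) L

  rightVertexG : ∀ {v} → isT (inj₂ v) → isG (inj₂ v)
  rightVertexG {v} (Vv , Lℓwv) = Vv , lang-suffix ℓ (w ++ v) (subst (Lang X) (++-assoc ℓ w v) Lℓwv)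

  neighbourOfℓ : ∀ y → adjG' y ℓ' → Σ (Word k) λ v → y ≡ inj₂ v × V v × Lang X (ℓ ++ w ++ v)
  neighbourOfℓ (inj₂ v) (_ , (Vv , _) , L) = v , refl , Vv , L

  attach : Vtx → Vtx
  attach (inj₁ u) = inj₁ (u ++ ℓ)
  attach (inj₂ v) = inj₂ v

  attach-leftEdge : ∀ u v → adjT (inj₁ u) (inj₂ v) → adjG (inj₁ (u ++ ℓ)) (inj₂ v)
  attach-leftEdge u v (((a , refl) , Laℓw) , (Vv , Lℓwv) , Laℓwv) =
    (AℓU a (lang-prefix (a ∷ ℓ) w Laℓw) , Laℓw) ,
    rightVertexG (Vv , Lℓwv) ,
    subst (λ z → Lang X (a ∷ z)) (++-assoc ℓ w v) Laℓwv

  attach-edge : ∀ {x y} → adjT x y → adjG (attach x) (attach y)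
  attach-edge {inj₁ u} {inj₂ v} e = attach-leftEdge u v e
  attach-edge {inj₂ v} {inj₁ u} e = attach-leftEdge u v e

  RightOrMerged : Vtx → Set
  RightOrMerged p = (Σ (Word k) λ v → p ≡ inj₂ v) ⊎ Merged p

  attach-rightOrMerged : ∀ {y} → isT y → RightOrMerged (attach y)
  attach-rightOrMerged {inj₁ .([ a ])} ((a , refl) , _) = inj₂ (a , refl)
  attach-rightOrMerged {inj₂ v} _ = inj₁ (v , refl)

  detach : Vtx → Vtx
  detach (inj₁ []) = inj₁ []
  detach (inj₁ (a ∷ _)) = inj₁ [ a ]
  detach (inj₂ v) = inj₂ v

  detach-leftEdge : ∀ u v → Merged (inj₁ u) → adjG (inj₁ u) (inj₂ v) → adjT (detach (inj₁ u)) (inj₂ v)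
  detach-leftEdge .(a ∷ ℓ) v (a , refl) ((Uu , Laℓw) , (Vv , Lwv) , Laℓwv) =
    ((a , refl) , Laℓw) ,
    (Vv , subst (Lang X) (sym (++-assoc ℓ w v)) (lang-suffix [ a ] _ Laℓwv)) ,
    subst (λ z → Lang X (a ∷ z)) (sym (++-assoc ℓ w v)) Laℓwv

  notKept-merged : ∀ u → ¬ Kept (inj₁ u) → Merged (inj₁ u)
  notKept-merged u nk with extends? u
  ... | yes m = m
  ... | no n = ⊥-elim (nk n)

  detach-edge : ∀ {x y} → ¬ Kept x → ¬ Kept y → adjG x y → adjT (detach x) (detach y)
  detach-edge {inj₁ u} {inj₂ v} nx ny e = detach-leftEdge u v (notKept-merged u nx) e
  detach-edge {inj₂ v} {inj₁ u} nx ny e =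
    ET.adj-sym (detach (inj₁ u)) (inj₂ v) (detach-leftEdge u v (notKept-merged u ny) e)

  detach-injective : ∀ {x y} → ¬ Kept x → ¬ Kept y → detach x ≡ detach y → x ≡ y
  detach-injective {inj₁ u} {inj₁ u'} nx ny e with notKept-merged u nx | notKept-merged u' ny
  detach-injective {inj₁ .(a ∷ ℓ)} {inj₁ .(b ∷ ℓ)} nx ny refl | a , refl | b , refl = refl
  detach-injective {inj₁ u} {inj₂ v} nx ny e with notKept-merged u nx
  detach-injective {inj₁ .(a ∷ ℓ)} {inj₂ v} nx ny () | a , refl
  detach-injective {inj₂ v} {inj₁ u} nx ny e with notKept-merged u ny
  detach-injective {inj₂ v} {inj₁ .(a ∷ ℓ)} nx ny () | a , refl
  detach-injective {inj₂ v} {inj₂ .v} nx ny refl = refl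

  nonempty-G : Graph.NonEmpty isT adjT → Graph.NonEmpty isG adjG
  nonempty-G (inj₁ .([ a ]) , ((a , refl) , Laℓw)) =
    inj₁ (a ∷ ℓ) , AℓU a (lang-prefix (a ∷ ℓ) w Laℓw) , Laℓw
  nonempty-G (inj₂ v , tv) = inj₂ v , rightVertexG tv

  nonempty-G' : Graph.NonEmpty isT adjT → Graph.NonEmpty isG' adjG'
  nonempty-G' (inj₁ .([ a ]) , ((a , refl) , Laℓw)) = ℓ' , inj₂ refl , lang-suffix [ a ] (ℓ ++ w) Laℓw
  nonempty-G' (inj₂ v , tv) = inj₂ v , rightVertexG tv

  collapse-onto : ∀ {x'} → isG' x' → Σ Vtx λ x → isG x × collapse x ≡ x'
  collapse-onto {inj₁ u} (inj₁ (Uu , n) , Luw) = inj₁ u , (Uu , Luw) , collapse-id (inj₁ u) n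
  collapse-onto {inj₁ u} (inj₂ refl , Lℓw) with lang-extendLeft (ℓ ++ w) Lℓw
  ... | a , Laℓw = inj₁ (a ∷ ℓ) , (AℓU a (lang-prefix (a ∷ ℓ) w Laℓw) , Laℓw) , collapse-extends a
  collapse-onto {inj₂ v} p = inj₂ v , p , refl

  connected-G' : Graph.Connected isG adjG → Graph.Connected isG' adjG'
  connected-G' connG x' y' vx' vy' with collapse-onto vx' | collapse-onto vy'
  ... | x , vx , refl | y , vy , refl = Walks.walk-map collapse collapse-edge (connG x y vx vy)

  module Lifting (connT : Graph.Connected isT adjT) where

    walkViaT : ∀ {x y} → isT x → isT y → WalkG (attach x) (attach y)
    walkViaT {x} {y} tx ty = Walks.walk-map attach attach-edge (connT x y tx ty)

    mergedOrNot : ∀ {x} → isG x →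
      (Σ (Alphabet k) λ a → x ≡ inj₁ (a ∷ ℓ) × Lang X (a ∷ ℓ ++ w)) ⊎ (¬ Merged x)
    mergedOrNot {inj₁ u} (_ , Luw) with extends? u
    ... | yes (a , refl) = inj₁ (a , refl , Luw)
    ... | no n = inj₂ n
    mergedOrNot {inj₂ v} _ = inj₂ (λ ())

    sameImage : ∀ {x y} → isG x → isG y → collapse x ≡ collapse y → WalkG x y
    sameImage {x} {y} vx vy eq with mergedOrNot vx | mergedOrNot vy
    ... | inj₁ (a , refl , Laℓw) | inj₁ (b , refl , Lbℓw) = walkViaT ((a , refl) , Laℓw) ((b , refl) , Lbℓw)
    ... | inj₁ (a , refl , _) | inj₂ ny =
      ⊥-elim (vertexG≢ℓ vy (trans (sym (collapse-extends a)) (trans eq (collapse-id y ny))))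
    ... | inj₂ nx | inj₁ (b , refl , _) =
      ⊥-elim (vertexG≢ℓ vx (trans (sym (collapse-extends b)) (trans (sym eq) (collapse-id x nx))))
    ... | inj₂ nx | inj₂ ny = subst (WalkG x) (trans (sym (collapse-id x nx)) (trans eq (collapse-id y ny))) Graph.here

    -- Lifting one edge ℓ — v of G' starting from a merged vertex aℓ: go to v through T.
    liftFromMerged : ∀ a p' → Lang X (a ∷ ℓ ++ w) → adjG' ℓ' p' →
      Σ Vtx λ x' → isG x' × collapse x' ≡ p' × WalkG (inj₁ (a ∷ ℓ)) x'
    liftFromMerged a (inj₂ v) Laℓw (_ , (Vv , Lwv) , Lℓwv) =
      inj₂ v , (Vv , Lwv) , refl , walkViaT {inj₁ [ a ]} ((a , refl) , Laℓw) (rightVertexT Vv Lℓwv)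

    -- Lifting an edge v — ℓ of G': v is adjacent in G to some merged vertex aℓ.
    liftIntoℓ : ∀ v → isG (inj₂ v) → adjG' (inj₂ v) ℓ' →
      Σ Vtx λ x' → isG x' × collapse x' ≡ ℓ' × WalkG (inj₂ v) x'
    liftIntoℓ v (Vv , Lwv) (_ , _ , Lℓwv) with lang-extendLeft (ℓ ++ w ++ v) Lℓwv
    ... | a , Laℓwv = inj₁ (a ∷ ℓ) , vaℓ , collapse-extends a , Graph.step (vaℓ , (Vv , Lwv) , Laℓwv) Graph.here
      where
      vaℓ : isG (inj₁ (a ∷ ℓ))
      vaℓ = AℓU a (lang-prefix (a ∷ ℓ) (w ++ v) Laℓwv) ,
            lang-prefix (a ∷ ℓ ++ w) v (subst (λ z → Lang X (a ∷ z)) (sym (++-assoc ℓ w v)) Laℓwv)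

    liftFromUnmerged : ∀ x p' → isG x → adjG' x p' → Σ Vtx λ x' → isG x' × collapse x' ≡ p' × WalkG x x'
    liftFromUnmerged x p' vx e with ℓ' ≟v p'
    liftFromUnmerged (inj₂ v) .ℓ' vx e | yes refl = liftIntoℓ v vx e
    liftFromUnmerged (inj₁ u) .ℓ' vx () | yes refl
    ... | no ℓ≢p' = p' , vertexG'→G vp' ℓ≢p' , collapse-id p' (vertexG'-unmerged vp' ℓ≢p') ,
                    Graph.step (edgeG'→G e (vertexG≢ℓ vx) ℓ≢p') Graph.here
      where
      vp' : isG' p'
      vp' = EG'.adj-target x p' e

    liftStep : ∀ {p p'} x → isG x → collapse x ≡ p → adjG' p p' →
      Σ Vtx λ x' → isG x' × collapse x' ≡ p' × WalkG x x'
    liftStep {p} {p'} x vx ex e with mergedOrNot vx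
    ... | inj₁ (a , refl , Laℓw) =
      liftFromMerged a p' Laℓw (subst (λ z → adjG' z p') (trans (sym ex) (collapse-extends a)) e)
    ... | inj₂ n = liftFromUnmerged x p' vx (subst (λ z → adjG' z p') (trans (sym ex) (collapse-id x n)) e)

    liftWalk : ∀ {p q} → WalkG' p q → ∀ x y → isG x → isG y → collapse x ≡ p → collapse y ≡ q → WalkG x y
    liftWalk Graph.here x y vx vy ex ey = sameImage vx vy (trans ex (sym ey))
    liftWalk (Graph.step e W) x y vx vy ex ey with liftStep x vx ex e
    ... | x' , vx' , ex' , W₁ = Walks.walk-++ W₁ (liftWalk W x' y vx' vy ex' ey)

  connected-G : Graph.Connected isT adjT → Graph.Connected isG' adjG' → Graph.Connected isG adjG
  connected-G connT connG' x y vx vy =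
    liftWalk (connG' (collapse x) (collapse y) (collapse-vertex vx) (collapse-vertex vy)) x y vx vy refl refl
    where open Lifting connT

  detachCycle : ∀ {x xs} → IsCycle adjG x xs → All (λ v → ¬ Kept v) (x ∷ xs) →
                IsCycle adjT (detach x) (map detach xs)
  detachCycle {x} {xs} (len , uq , lk) nk =
    subst (3 ≤ℕ_) (cong suc (sym (length-map detach xs))) len ,
    Unique-mapOn detach detach-injective nk uq ,
    subst (λ z → Linked adjT (detach x ∷ z)) (map-++ detach xs [ x ])
      (Linked-map⁺ (Linked-restrict detach-edge (All-loop nk) lk))

  unmergedCycle : ∀ {x xs} → IsCycle adjG x xs → All (λ v → ¬ Merged v) (x ∷ xs) → IsCycle adjG' x xs
  unmergedCycle (len , uq , lk) nm = len , uq , Linked-restrict unmergedEdge (All-loop nm) lk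

  cycle-avoidsℓ : ∀ {x xs} → IsCycle adjG x xs → All (λ y → ¬ ℓ' ≡ y) (x ∷ xs)
  cycle-avoidsℓ {x} {xs} (_ , _ , lk) =
    All.map (λ (_ , e) → vertexG≢ℓ (EG.adj-source _ _ e)) (Linked-sources (x ∷ xs) x lk)

  shortcutCycle : ∀ {u t₁ t₂} A B → Kept u → Merged t₁ → Merged t₂ →
    All (λ v → ¬ Merged v) A → All (λ v → ¬ Merged v) B →
    Linked adjG (t₁ ∷ A ++ [ u ]) → Linked adjG (u ∷ B ++ [ t₂ ]) →
    Unique (A ++ u ∷ B) → All (λ y → ¬ ℓ' ≡ y) (A ++ u ∷ B) →
    IsCycle adjG' ℓ' (A ++ u ∷ B)
  shortcutCycle {u} {t₁} {t₂} A B ku mt₁ mt₂ nA nB arcIn arcOut uq ℓ∉ =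
    length-ok B arcOut , ℓ∉ ∷ uq ,
    subst (λ z → Linked adjG' (ℓ' ∷ z)) (sym (++-assoc A (u ∷ B) [ ℓ' ]))
      (Linked-glue (ℓ' ∷ A) u (B ++ [ ℓ' ]) arcIn' arcOut')
    where
    nu : ¬ Merged u
    nu = kept⇒¬merged u ku
    arcIn' : Linked adjG' (ℓ' ∷ A ++ [ u ])
    arcIn' = subst (Linked adjG')
               (cong₂ _∷_ (collapse-merged t₁ mt₁) (map-collapse-id (A ++ [ u ]) (++⁺ nA (nu ∷ []))))
               (Linked-image collapse collapse-edge arcIn)
    arcOut' : Linked adjG' (u ∷ B ++ [ ℓ' ])
    arcOut' = subst (Linked adjG')
                (cong₂ _∷_ (collapse-id u nu)
                  (trans (map-++ collapse B [ t₂ ])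
                    (cong₂ _++_ (map-collapse-id B nB) (cong [_] (collapse-merged t₂ mt₂)))))
                (Linked-image collapse collapse-edge arcOut)
    -- B is nonempty, since the left vertices u and t₂ are not adjacent.
    length-ok : ∀ B → Linked adjG (u ∷ B ++ [ t₂ ]) → 3 ≤ℕ length (ℓ' ∷ A ++ u ∷ B)
    length-ok [] (e ∷ _) = ⊥-elim (kept-merged-nonadjacent ku mt₂ e)
    length-ok (b ∷ B') _ = s≤s (≤-trans (s≤s (s≤s z≤n)) (length-++-≤ʳ (u ∷ b ∷ B') {A}))

  -- A cycle of G through a kept vertex u and some merged vertex yields a
  -- cycle of G' through ℓ: cut it at the first and the last merged vertex.
  cycleThroughMerged : ∀ {u rest} → Kept u → IsCycle adjG u rest → Any Merged rest →
                       Σ (List Vtx) (IsCycle adjG' ℓ')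
  cycleThroughMerged {u} {rest} ku c@(_ , uq , lk) m with splitAtFirst merged? rest m
  ... | B , t₂ , M , refl , nB , mt₂ with splitAtLast merged? (t₂ ∷ M) (here mt₂)
  ... | D , t₁ , A , eqD , mt₁ , nA =
    A ++ u ∷ B , shortcutCycle A B ku mt₁ mt₂ nA nB arcIn arcOut
                   (AllPairs.tail (Unique-dropMiddle (u ∷ B) D (t₁ ∷ A) (subst Unique eqCycle uq)))
                   (All.tail (All-dropMiddle (u ∷ B) D (t₁ ∷ A) (subst (All _) eqCycle (cycle-avoidsℓ c))))
    where
    eqCycle : u ∷ B ++ t₂ ∷ M ≡ u ∷ B ++ D ++ t₁ ∷ A
    eqCycle = cong (λ z → u ∷ B ++ z) eqD
    arcOut : Linked adjG (u ∷ B ++ [ t₂ ])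
    arcOut = Linked-upTo u B t₂ (M ++ [ u ]) (subst (λ z → Linked adjG (u ∷ z)) (++-assoc B (t₂ ∷ M) [ u ]) lk)
    arcIn : Linked adjG (t₁ ∷ A ++ [ u ])
    arcIn = Linked-from u (B ++ D) t₁ (A ++ [ u ]) (subst (λ z → Linked adjG (u ∷ z)) eqLoop lk)
      where
      open ≡-Reasoning
      eqLoop : (B ++ t₂ ∷ M) ++ [ u ] ≡ (B ++ D) ++ t₁ ∷ A ++ [ u ]
      eqLoop = begin
        (B ++ t₂ ∷ M) ++ [ u ]     ≡⟨ ++-assoc B (t₂ ∷ M) [ u ] ⟩
        B ++ (t₂ ∷ M) ++ [ u ]     ≡⟨ cong (λ z → B ++ z ++ [ u ]) eqD ⟩
        B ++ (D ++ t₁ ∷ A) ++ [ u ] ≡⟨ cong (B ++_) (++-assoc D (t₁ ∷ A) [ u ]) ⟩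
        B ++ D ++ t₁ ∷ A ++ [ u ]   ≡⟨ ++-assoc B D (t₁ ∷ A ++ [ u ]) ⟨
        (B ++ D) ++ t₁ ∷ A ++ [ u ] ∎

  acyclic-G : Graph.Acyclic isT adjT → Graph.Acyclic isG' adjG' → Graph.Acyclic isG adjG
  acyclic-G acT acG' (x , xs , c) with any? kept? (x ∷ xs)
  ... | no noKept = acT (detach x , map detach xs , detachCycle c (¬Any⇒All¬ (x ∷ xs) noKept))
  ... | yes someKept with find someKept
  ... | u , u∈ , ku with rotateCycle c u∈
  ... | rest , c' with any? merged? rest
  ...   | no noMerged = acG' (u , rest , unmergedCycle c' (kept⇒¬merged u ku ∷ ¬Any⇒All¬ rest noMerged))
  ...   | yes someMerged = acG' (ℓ' , cycleThroughMerged ku c' someMerged)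

  pathViaT : Graph.Connected isT adjT → ∀ {v v'} → isT (inj₂ v) → isT (inj₂ v') →
    Σ (List Vtx) λ ys → Linked adjG (inj₂ v ∷ ys) × Unique (inj₂ v ∷ ys) ×
      lastOf (inj₂ v) ys ≡ inj₂ v' × All RightOrMerged (inj₂ v ∷ ys)
  pathViaT connT {v} {v'} tv tv' with Walks.walk→linked isT (λ {a} {b} e → ET.adj-target a b e) tv (connT _ _ tv tv')
  ... | xs , lk , last , inT with erasePath RightOrMerged (inj₂ v) (map attach xs)
                                   (Linked-image attach attach-edge lk) (map⁺ (All.map attach-rightOrMerged inT))
  ... | ys , lkY , uY , lastY , qY =
    ys , lkY , uY , trans lastY (trans (lastOf-map attach (inj₂ v) xs) (cong attach last)) , qY

  cycleAvoidingℓ : ∀ {x xs} → IsCycle adjG' x xs → ¬ ℓ' ∈ x ∷ xs → IsCycle adjG x xs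
  cycleAvoidingℓ (len , uq , lk) ℓ∉ = len , uq , pathAvoidingℓ (All-loop (¬Any⇒All¬ _ ℓ∉)) lk

  -- A cycle ℓ v₁ u₂ ⋯ vₘ of G' through ℓ gives the G-path v₁ u₂ ⋯ vₘ, which
  -- together with a path vₘ ⇝ v₁ through T contains a cycle of G.
  cycleThroughℓ : Graph.Connected isT adjT → ∀ v₁ u₂ zs →
    IsCycle adjG' ℓ' (inj₂ v₁ ∷ inj₁ u₂ ∷ zs) → Σ Vtx λ c → Σ (List Vtx) (IsCycle adjG c)
  cycleThroughℓ connT v₁ u₂ zs (_ , ℓ∉ ∷ uq , e₁ ∷ lk@(e₁₂ ∷ _))
    with neighbourOfℓ (lastOf (inj₂ v₁) (inj₁ u₂ ∷ zs)) (Linked-lastStep (inj₂ v₁) (inj₁ u₂ ∷ zs) ℓ' lk)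
  ... | vₘ , lastIsVₘ , Vvₘ , Lℓwvₘ with pathViaT connT (rightVertexT Vvₘ Lℓwvₘ) (rightVertexT Vv₁ Lℓwv₁)
    where
    Vv₁ = proj₁ (proj₁ (proj₂ e₁))
    Lℓwv₁ = proj₂ (proj₂ e₁)
  ... | ys , lkP , uP , lastP , qP =
    cycleOfTwoPaths RightOrMerged (λ {x} → EG.adj-irrefl x) (inj₂ vₘ) ys C lkP uP qP
      (subst (λ z → Linked adjG (z ∷ C)) (sym lastP)
        (pathAvoidingℓ ℓ∉ (Linked-prefix (inj₂ v₁ ∷ C) [ ℓ' ] lk)))
      (subst (λ z → Unique (z ∷ C)) (sym lastP) uq)
      (subst (_∈ C) lastIsVₘ (lastOf-∈ (inj₁ u₂) zs))
      turn
    where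
    C : List Vtx
    C = inj₁ u₂ ∷ zs
    u₂-unmerged : ¬ Extends u₂
    u₂-unmerged = vertexG'-unmerged (proj₁ e₁₂) (All.head (All.tail ℓ∉))
    -- the T-path reaches v₁ from a merged vertex, while C leaves v₁ towards the unmerged u₂
    turn : ∀ {p z zs'} → RightOrMerged p → C ≡ z ∷ zs' → ¬ p ≡ z
    turn {inj₁ u} (inj₂ m) refl eq = u₂-unmerged (subst Extends (Sum.inj₁-injective eq) m)
    turn {inj₁ u} (inj₁ (_ , ())) _ _
    turn {inj₂ v} _ refl ()

  acyclic-G' : Graph.Connected isT adjT → Graph.Acyclic isG adjG → Graph.Acyclic isG' adjG'
  acyclic-G' connT acG (x , xs , c) with ℓ' ∈? (x ∷ xs)
  ... | no ℓ∉ = acG (x , xs , cycleAvoidingℓ c ℓ∉)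
  ... | yes ℓ∈ with rotateCycle c ℓ∈
  ... | [] , s≤s () , _
  ... | _ ∷ [] , s≤s (s≤s ()) , _
  ... | inj₁ _ ∷ _ ∷ _ , _ , _ , () ∷ _
  ... | inj₂ _ ∷ inj₂ _ ∷ _ , _ , _ , _ ∷ () ∷ _
  ... | inj₂ v₁ ∷ inj₁ u₂ ∷ zs , c' = acG (cycleThroughℓ connT v₁ u₂ zs c')

lemma8p2 : ∀ {k : ℕ} (X : ShiftSpace k) (w : Word k) (U V : WordSet k) (ℓ : Word k) →
    Lang X w →
    FiniteSet U → XMaximalSuffixCode X U →
    FiniteSet V → XMaximalPrefixCode X V →
    Lang X ℓ →
    (∀ (a : Alphabet k) → Lang X (a ∷ ℓ) → U (a ∷ ℓ)) →
    ExtTree X Letters V (ℓ ++ w) →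
    ExtTree X (replaceU U ℓ) V w ⇔ ExtTree X U V w
lemma8p2 X w U V ℓ _ _ (_ , suffixU , _) _ _ Lℓ AℓU (neT , connT , acT) =
  mk⇔ (λ (_ , connG' , acG') → nonempty-G neT , connected-G connT connG' , acyclic-G acT acG')
      (λ (_ , connG , acG) → nonempty-G' neT , connected-G' connG , acyclic-G' connT acG)
  where open Replacement X w U V ℓ Lℓ suffixU AℓU
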